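{- Let $S$ be a cap in $\Sigma=\mathrm{PG}(n,2)$, let $K_C$ be a hyperplane with $S\cap K_C=\{c_0\}$ a single point, and let $H_\infty\subset K_C$ be a subspace of codimension $2$ in $\Sigma$ with $S\cap H_\infty=\emptyset$. Let $K_A,K_B$ be the other two hyperplanes of $\Sigma$ containing $H_\infty$, put $H_A=K_A\setminus H_\infty$, $H_B=K_B\setminus H_\infty$, $A=S\cap H_A$, $B=S\cap H_B$, $B'=H_B\setminus B$, and suppose $B'=c_0+A$. Let $E=\Sigma\setminus\bigl(S\sqcup(S\oplus S)\bigr)$ and $T=S\sqcup E$. Then $T$ is a complete cap in $\Sigma$.
   Context: Points of $\mathrm{PG}(n,2)$ are the nonzero vectors of $\mathbb{F}_2^{n+1}$; three distinct points $x,y,z$ are collinear iff $x+y=z$. A cap is a set of points no three of which are collinear; it is complete if it is not properly contained in another cap of $\Sigma$. For sets $X,Y$: $X\oplus Y=\{x+y: x\in X, y\in Y, x\neq y\}$, and $z+X=\{z+x:x\in X\}$. -}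

module Defs where

open import Level using (0ℓ)
open import Data.Nat using (ℕ; suc)
open import Data.Bool using (Bool; true; false; _xor_; _∧_)
open import Data.Vec using (Vec; replicate; zipWith; foldr)
open import Data.Product using (Σ; ∃; _×_; _,_)
open import Data.Sum using (_⊎_)
open import Relation.Nullary using (¬_)
open import Relation.Unary using (Pred; _⊆_)
open import Relation.Binary.PropositionalEquality using (_≡_; _≢_)

-- Vectors of F_2^{n+1} (F_2 = Bool, addition = xor, multiplication = ∧)
Vect : ℕ → Set
Vect n = Vec Bool (suc n)

zeroV : (n : ℕ) → Vect n
zeroV n = replicate (suc n) false

infixl 6 _⊕_
_⊕_ : {n : ℕ} → Vect n → Vect n → Vect n
x ⊕ y = zipWith _xor_ x y

dot : {n : ℕ} → Vect n → Vect n → Bool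
dot a x = foldr _ _xor_ false (zipWith _∧_ a x)

IsPoint : {n : ℕ} → Vect n → Set
IsPoint {n} x = x ≢ zeroV n

PSet : ℕ → Set₁
PSet n = Pred (Vect n) 0ℓ

-- cap: a set of points, no three distinct of which are collinear (x + y = z)
IsCap : {n : ℕ} → PSet n → Set
IsCap {n} S =
  (∀ x → S x → IsPoint x) ×
  (∀ x y z → S x → S y → S z → x ≢ y → x ≢ z → y ≢ z → x ⊕ y ≢ z)

IsCompleteCap : {n : ℕ} → PSet n → Set₁
IsCompleteCap {n} T = IsCap T × (∀ (T' : PSet n) → IsCap T' → T ⊆ T' → T' ⊆ T)

Hyp : {n : ℕ} → Vect n → PSet n
Hyp a x = IsPoint x × dot a x ≡ false

SumSet : {n : ℕ} → PSet n → PSet n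
SumSet S z = ∃ λ x → ∃ λ y → S x × S y × x ≢ y × z ≡ x ⊕ y

Transl : {n : ℕ} → Vect n → PSet n → PSet n
Transl c X z = ∃ λ x → X x × z ≡ c ⊕ x

_≐_ : {n : ℕ} → PSet n → PSet n → Set
X ≐ Y = (X ⊆ Y) × (Y ⊆ X)

Ecomp : {n : ℕ} → PSet n → PSet n
Ecomp S x = IsPoint x × ¬ S x × ¬ SumSet S x

Tset : {n : ℕ} → PSet n → PSet n
Tset S x = S x ⊎ Ecomp S x

-- Write a, b for the normals of K_A, K_B.  Three distinct hyperplanes through the
-- codimension-2 subspace H∞ form a pencil, so K_C = ker (a ⊕ b), H_A ∪ H_B is the
-- complement of K_C, and translation by c₀ exchanges H_A and H_B.  Hence B′ = c₀ + A
-- says that every point y off K_C lies in S or has c₀ ⊕ y ∈ S.  Consequently E ⊆ K_C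
-- (otherwise e = c₀ ⊕ (c₀ ⊕ e) ∈ S ⊕ S), and for a fixed y₀ ∈ S off K_C the map
-- e ↦ c₀ ⊕ (e ⊕ y₀) sends E into S.  For e₁ ≠ e₂ in E this writes e₁ ⊕ e₂ as a sum of
-- two points of S, so it is not in E; and if e₁ ⊕ e₂ ∈ S then it lies in S ∩ K_C = {c₀},
-- which turns e₂ into the sum of c₀ ⊕ (e₁ ⊕ y₀) and y₀.  So no line of T = S ⊔ E meets E
-- twice, lines with two points in S miss E by definition of E, and every point outside
-- T lies in S ⊕ S, which gives completeness.

module Submission where

open import Defs
open import Algebra.Bundles using (AbelianGroup; CommutativeRing)
open import Algebra.Structures using (IsAbelianGroup)
import Algebra.Properties.AbelianGroup as AbelianGroupProperties
import Algebra.Properties.CommutativeSemigroup as CommutativeSemigroupProperties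
open import Level using (0ℓ)
open import Data.Nat using (ℕ; zero; suc)
open import Data.Bool using (Bool; true; false; _xor_; _∧_; not)
open import Data.Bool.Properties
  using ( xor-same; xor-assoc; xor-comm; xor-identityˡ; xor-identityʳ
        ; ∧-comm; ∧-zeroʳ; ∧-distribˡ-xor; xor-∧-commutativeRing )
  renaming (_≟_ to _≟ᴮ_)
open import Data.Vec using (Vec; []; _∷_; replicate; zipWith)
open import Data.Vec.Properties
  using (≡-dec; zipWith-assoc; zipWith-comm; zipWith-identityˡ; zipWith-identityʳ)
open import Data.Product using (_×_; _,_; proj₁; proj₂; ∃; Σ)
open import Data.Sum using (inj₁; inj₂)
open import Data.Empty using (⊥-elim)
open import Function using (_∘_; id)
open import Relation.Nullary using (¬_; yes; no)
open import Relation.Unary using (Decidable; _∩_; _⊆_; ∁)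
open import Relation.Binary.PropositionalEquality
  using (_≡_; _≢_; refl; sym; trans; cong; cong₂; subst; isEquivalence; module ≡-Reasoning)

private
  variable
    m n : ℕ
    a b e h k u v w x y z : Vect n

⊕-self : (x : Vec Bool m) → zipWith _xor_ x x ≡ replicate m false
⊕-self []       = refl
⊕-self (x ∷ xs) = cong₂ _∷_ (xor-same x) (⊕-self xs)

⊕-isAbelianGroup : IsAbelianGroup _≡_ (_⊕_ {n}) (zeroV n) id
⊕-isAbelianGroup = record
  { isGroup = record
    { isMonoid = record
      { isSemigroup = record
        { isMagma = record { isEquivalence = isEquivalence ; ∙-cong = cong₂ _⊕_ }
        ; assoc   = zipWith-assoc xor-assoc
        }
      ; identity = zipWith-identityˡ xor-identityˡ , zipWith-identityʳ xor-identityʳ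
      }
    ; inverse = ⊕-self , ⊕-self
    ; ⁻¹-cong = cong id
    }
  ; comm = zipWith-comm xor-comm
  }

⊕-abelianGroup : ℕ → AbelianGroup 0ℓ 0ℓ
⊕-abelianGroup n = record { isAbelianGroup = ⊕-isAbelianGroup {n} }

open module ⊕-Properties {n} = AbelianGroupProperties (⊕-abelianGroup n)
  using (identityˡ-unique; identityʳ-unique)
  renaming ( ∙-cancelˡ to ⊕-cancelˡ
           ; y≈x\\z to x⊕y≡z⇒y≡x⊕z
           ; x≈z//y to x⊕y≡z⇒x≡z⊕y
           ; x∙y⁻¹≈ε⇒x≈y to x⊕y≡0⇒x≡y
           ; x≈y⇒x∙y⁻¹≈ε to x≡y⇒x⊕y≡0
           )

open module ⊕-Group {n} = AbelianGroup (⊕-abelianGroup n)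
  using () renaming (comm to ⊕-comm; assoc to ⊕-assoc)

x⊕[x⊕y]≡y : (x y : Vect n) → x ⊕ (x ⊕ y) ≡ y
x⊕[x⊕y]≡y x y = sym (x⊕y≡z⇒y≡x⊕z x y (x ⊕ y) refl)

[x⊕y]⊕y≡x : (x y : Vect n) → (x ⊕ y) ⊕ y ≡ x
[x⊕y]⊕y≡x x y = sym (x⊕y≡z⇒x≡z⊕y x y (x ⊕ y) refl)

[x⊕y]⊕[x⊕z]≡y⊕z : (x y z : Vect n) → (x ⊕ y) ⊕ (x ⊕ z) ≡ y ⊕ z
[x⊕y]⊕[x⊕z]≡y⊕z x y z = begin
  (x ⊕ y) ⊕ (x ⊕ z)  ≡⟨ cong (_⊕ (x ⊕ z)) (⊕-comm x y) ⟩
  (y ⊕ x) ⊕ (x ⊕ z)  ≡⟨ ⊕-assoc y x (x ⊕ z) ⟩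
  y ⊕ (x ⊕ (x ⊕ z))  ≡⟨ cong (y ⊕_) (x⊕[x⊕y]≡y x z) ⟩
  y ⊕ z              ∎
  where open ≡-Reasoning

[x⊕z]⊕[y⊕z]≡x⊕y : (x y z : Vect n) → (x ⊕ z) ⊕ (y ⊕ z) ≡ x ⊕ y
[x⊕z]⊕[y⊕z]≡x⊕y x y z =
  trans (cong₂ _⊕_ (⊕-comm x z) (⊕-comm y z)) ([x⊕y]⊕[x⊕z]≡y⊕z z x y)

xor≡false⇒≡ : ∀ {p q} → p xor q ≡ false → p ≡ q
xor≡false⇒≡ {true}  {true}  _ = refl
xor≡false⇒≡ {false} {false} _ = refl

≡⇒xor≡false : ∀ {p q} → p ≡ q → p xor q ≡ false
≡⇒xor≡false {p} refl = xor-same p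

open CommutativeSemigroupProperties (CommutativeRing.+-commutativeSemigroup xor-∧-commutativeRing)
  using () renaming (interchange to xor-interchange)

∧-distribˡ-xor-interchange : ∀ a x y p q →
  (a ∧ (x xor y)) xor (p xor q) ≡ ((a ∧ x) xor p) xor ((a ∧ y) xor q)
∧-distribˡ-xor-interchange a x y p q =
  trans (cong (_xor (p xor q)) (∧-distribˡ-xor a x y)) (xor-interchange (a ∧ x) (a ∧ y) p q)

dot-comm : (a x : Vect n) → dot a x ≡ dot x a
dot-comm {zero}  (a ∷ [])          (x ∷ [])  = cong (_xor false) (∧-comm a x)
dot-comm {suc n} (a ∷ as@(_ ∷ _)) (x ∷ xs) = cong₂ _xor_ (∧-comm a x) (dot-comm as xs)

dot-zeroʳ : (a : Vect n) → dot a (zeroV n) ≡ false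
dot-zeroʳ {zero}  (a ∷ [])          = cong (_xor false) (∧-zeroʳ a)
dot-zeroʳ {suc n} (a ∷ as@(_ ∷ _)) = cong₂ _xor_ (∧-zeroʳ a) (dot-zeroʳ as)

dot-zeroˡ : (x : Vect n) → dot (zeroV n) x ≡ false
dot-zeroˡ x = trans (dot-comm _ x) (dot-zeroʳ x)

dot-⊕ʳ : (a x y : Vect n) → dot a (x ⊕ y) ≡ dot a x xor dot a y
dot-⊕ʳ {zero}  (a ∷ [])          (x ∷ [])  (y ∷ [])  = ∧-distribˡ-xor-interchange a x y false false
dot-⊕ʳ {suc n} (a ∷ as@(_ ∷ _)) (x ∷ xs) (y ∷ ys) =
  trans (cong ((a ∧ (x xor y)) xor_) (dot-⊕ʳ as xs ys))
        (∧-distribˡ-xor-interchange a x y (dot as xs) (dot as ys))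

dot-⊕ˡ : (a b x : Vect n) → dot (a ⊕ b) x ≡ dot a x xor dot b x
dot-⊕ˡ a b x = trans (dot-comm (a ⊕ b) x)
  (trans (dot-⊕ʳ x a b) (cong₂ _xor_ (dot-comm x a) (dot-comm x b)))

dot-nondegenerate : (a : Vect n) → IsPoint a → ∃ λ x → dot a x ≡ true
dot-nondegenerate {zero}  (true ∷ [])  _ = true ∷ [] , refl
dot-nondegenerate {zero}  (false ∷ []) a≢0 = ⊥-elim (a≢0 refl)
dot-nondegenerate {suc n} (true ∷ as)  _ = true ∷ zeroV n , cong not (dot-zeroʳ as)
dot-nondegenerate {suc n} (false ∷ as) a≢0 =
  let x , a·x = dot-nondegenerate as (a≢0 ∘ cong (false ∷_)) in false ∷ x , a·x

dot-injective : (∀ x → dot a x ≡ dot b x) → a ≡ b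
dot-injective {a = a} {b} a·≗b· with ≡-dec _≟ᴮ_ a b
... | yes a≡b = a≡b
... | no  a≢b with dot-nondegenerate (a ⊕ b) (a≢b ∘ x⊕y≡0⇒x≡y a b)
...   | x , [a⊕b]·x with trans (sym [a⊕b]·x) (trans (dot-⊕ˡ a b x) (≡⇒xor≡false (a·≗b· x)))
...     | ()

separate : IsPoint a → a ≢ b → ∃ λ x → dot a x ≡ true × dot b x ≡ false
separate {a = a} {b} a≢0 a≢b
  with dot-nondegenerate a a≢0 | dot-nondegenerate (a ⊕ b) (a≢b ∘ x⊕y≡0⇒x≡y a b)
... | y , a·y | z , [a⊕b]·z with dot a z in a·z | dot b z in b·z | trans (sym (dot-⊕ˡ a b z)) [a⊕b]·z
...   | true  | false | _ = z , a·z , b·z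
...   | false | true  | _ with dot b y in b·y
...     | false = y , a·y , b·y
...     | true  = y ⊕ z , trans (dot-⊕ʳ a y z) (cong₂ _xor_ a·y a·z)
                        , trans (dot-⊕ʳ b y z) (cong₂ _xor_ b·y b·z)

dot≡true⇒IsPoint : dot a x ≡ true → IsPoint x
dot≡true⇒IsPoint {a = a} a·x refl with trans (sym a·x) (dot-zeroʳ a)
... | ()

-- Unlike Hyp a, this contains the zero vector, so kernels are subspaces.
Kernel : Vect n → PSet n
Kernel a x = dot a x ≡ false

dot-factors : Kernel u ∩ Kernel v ⊆ Kernel k →
              dot u x ≡ dot u y → dot v x ≡ dot v y → dot k x ≡ dot k y
dot-factors {u = u} {v} {k} {x} {y} k⊇ u·x≡u·y v·x≡v·y =
  xor≡false⇒≡ (trans (sym (dot-⊕ʳ k x y)) (k⊇ (kernel u u·x≡u·y , kernel v v·x≡v·y)))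
  where
    kernel : ∀ a → dot a x ≡ dot a y → Kernel a (x ⊕ y)
    kernel a e = trans (dot-⊕ʳ a x y) (≡⇒xor≡false e)

record DualBasis (u v : Vect n) : Set where
  field
    x₁ x₂ : Vect n
    u·x₁  : dot u x₁ ≡ true
    v·x₁  : dot v x₁ ≡ false
    u·x₂  : dot u x₂ ≡ false
    v·x₂  : dot v x₂ ≡ true

dualBasis : IsPoint u → IsPoint v → u ≢ v → DualBasis u v
dualBasis u≢0 v≢0 u≢v =
  let x₁ , u·x₁ , v·x₁ = separate u≢0 u≢v
      x₂ , v·x₂ , u·x₂ = separate v≢0 (u≢v ∘ sym)
  in record { x₁ = x₁ ; x₂ = x₂ ; u·x₁ = u·x₁ ; v·x₁ = v·x₁ ; u·x₂ = u·x₂ ; v·x₂ = v·x₂ }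

module _ {u v : Vect n} (B : DualBasis u v) where
  open DualBasis B

  annihilator-determined : Kernel u ∩ Kernel v ⊆ Kernel k → Kernel u ∩ Kernel v ⊆ Kernel w →
                           dot k x₁ ≡ dot w x₁ → dot k x₂ ≡ dot w x₂ → k ≡ w
  annihilator-determined {k = k} {w = w} k⊇ w⊇ k·x₁≡w·x₁ k·x₂≡w·x₂ = dot-injective agree
    where
      via : ∀ {y} z → dot u y ≡ dot u z → dot v y ≡ dot v z → dot k z ≡ dot w z → dot k y ≡ dot w y
      via z u·y≡u·z v·y≡v·z k·z≡w·z =
        trans (dot-factors {u = u} {v} {k} k⊇ u·y≡u·z v·y≡v·z)
              (trans k·z≡w·z (sym (dot-factors {u = u} {v} {w} w⊇ u·y≡u·z v·y≡v·z)))

      at-x₁⊕x₂ : ∀ a → dot a (x₁ ⊕ x₂) ≡ dot a x₁ xor dot a x₂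
      at-x₁⊕x₂ a = dot-⊕ʳ a x₁ x₂

      agree : ∀ y → dot k y ≡ dot w y
      agree y with dot u y in u·y | dot v y in v·y
      ... | false | false = trans (k⊇ (u·y , v·y)) (sym (w⊇ (u·y , v·y)))
      ... | true  | false = via x₁ (trans u·y (sym u·x₁)) (trans v·y (sym v·x₁)) k·x₁≡w·x₁
      ... | false | true  = via x₂ (trans u·y (sym u·x₂)) (trans v·y (sym v·x₂)) k·x₂≡w·x₂
      ... | true  | true  = via (x₁ ⊕ x₂)
        (trans u·y (sym (trans (at-x₁⊕x₂ u) (cong₂ _xor_ u·x₁ u·x₂))))
        (trans v·y (sym (trans (at-x₁⊕x₂ v) (cong₂ _xor_ v·x₁ v·x₂))))
        (trans (at-x₁⊕x₂ k) (trans (cong₂ _xor_ k·x₁≡w·x₁ k·x₂≡w·x₂) (sym (at-x₁⊕x₂ w))))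

-- Normals of the hyperplanes through ker u ∩ ker v.
data Pencil (u v : Vect n) : Vect n → Set where
  first  : Pencil u v u
  second : Pencil u v v
  third  : Pencil u v (u ⊕ v)

pencil-kernel : Pencil u v w → Kernel u ∩ Kernel v ⊆ Kernel w
pencil-kernel first  (u·x , _)   = u·x
pencil-kernel second (_ , v·x)   = v·x
pencil-kernel {u = u} {v} third {x} (u·x , v·x) = trans (dot-⊕ˡ u v x) (cong₂ _xor_ u·x v·x)

pencil : IsPoint u → IsPoint v → u ≢ v → IsPoint k → Kernel u ∩ Kernel v ⊆ Kernel k → Pencil u v k
pencil {u = u} {v} {k} u≢0 v≢0 u≢v k≢0 k⊇ = by-values (dot k x₁) (dot k x₂) refl refl
  where
    B : DualBasis u v
    B = dualBasis u≢0 v≢0 u≢v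
    open DualBasis B

    equals : Pencil u v w → dot k x₁ ≡ dot w x₁ → dot k x₂ ≡ dot w x₂ → Pencil u v k
    equals p k·x₁ k·x₂ =
      subst (Pencil u v) (sym (annihilator-determined B k⊇ (pencil-kernel p) k·x₁ k·x₂)) p

    by-values : ∀ p q → dot k x₁ ≡ p → dot k x₂ ≡ q → Pencil u v k
    by-values true  false k·x₁ k·x₂ = equals first  (trans k·x₁ (sym u·x₁)) (trans k·x₂ (sym u·x₂))
    by-values false true  k·x₁ k·x₂ = equals second (trans k·x₁ (sym v·x₁)) (trans k·x₂ (sym v·x₂))
    by-values true  true  k·x₁ k·x₂ = equals third
      (trans k·x₁ (sym (trans (dot-⊕ˡ u v x₁) (cong₂ _xor_ u·x₁ v·x₁))))
      (trans k·x₂ (sym (trans (dot-⊕ˡ u v x₂) (cong₂ _xor_ u·x₂ v·x₂))))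
    by-values false false k·x₁ k·x₂ = ⊥-elim (k≢0 (annihilator-determined B k⊇
      (λ {x} _ → dot-zeroˡ x) (trans k·x₁ (sym (dot-zeroˡ x₁))) (trans k·x₂ (sym (dot-zeroˡ x₂)))))

pencil-swap : Pencil u v w → Pencil v u w
pencil-swap first  = second
pencil-swap second = first
pencil-swap {u = u} {v} third = subst (Pencil v u) (⊕-comm v u) third

pencil-rebase : Pencil u v a → Pencil u v b → a ≢ b → Pencil u v w → Pencil a b w
pencil-rebase first  first  a≢b _ = ⊥-elim (a≢b refl)
pencil-rebase second second a≢b _ = ⊥-elim (a≢b refl)
pencil-rebase third  third  a≢b _ = ⊥-elim (a≢b refl)
pencil-rebase first  second _ w = w
pencil-rebase second first  _ w = pencil-swap w
pencil-rebase first  third  _ first  = first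
pencil-rebase {u = u} {v} first third _ second = subst (Pencil u (u ⊕ v)) (x⊕[x⊕y]≡y u v) third
pencil-rebase first  third  _ third  = second
pencil-rebase {u = u} {v} second third _ first =
  subst (Pencil v (u ⊕ v)) (trans (cong (v ⊕_) (⊕-comm u v)) (x⊕[x⊕y]≡y v u)) third
pencil-rebase second third  _ second = first
pencil-rebase second third  _ third  = second
pencil-rebase third  first  _ first  = second
pencil-rebase {u = u} {v} third first _ second =
  subst (Pencil (u ⊕ v) u) (trans (cong (_⊕ u) (⊕-comm u v)) ([x⊕y]⊕y≡x v u)) third
pencil-rebase third  first  _ third  = first
pencil-rebase {u = u} {v} third second _ first =
  subst (Pencil (u ⊕ v) v) ([x⊕y]⊕y≡x u v) third
pencil-rebase third  second _ second = second
pencil-rebase third  second _ third  = first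

pencil-other : Pencil a b w → w ≢ a → w ≢ b → w ≡ a ⊕ b
pencil-other first  w≢a _ = ⊥-elim (w≢a refl)
pencil-other second _ w≢b = ⊥-elim (w≢b refl)
pencil-other third  _ _   = refl

hyperplanes-⊆⇒kernels-⊆ : (∀ x → Hyp u x × Hyp v x → Hyp k x) → Kernel u ∩ Kernel v ⊆ Kernel k
hyperplanes-⊆⇒kernels-⊆ {k = k} H⊆ {x} (u·x , v·x) with ≡-dec _≟ᴮ_ x (zeroV _)
... | yes refl = dot-zeroʳ k
... | no  x≢0  = proj₂ (H⊆ x ((x≢0 , u·x) , (x≢0 , v·x)))

SumSet-intro : {S : PSet n} → S x → S y → IsPoint z → z ≡ x ⊕ y → SumSet S z
SumSet-intro {x = x} {y} Sx Sy z≢0 z≡x⊕y =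
  x , y , Sx , Sy , (λ x≡y → z≢0 (trans z≡x⊕y (x≡y⇒x⊕y≡0 x≡y))) , z≡x⊕y

module _ {S : PSet n} where

  Tset-isCap : IsCap S → SumSet (Ecomp S) ⊆ ∁ (Tset S) → IsCap (Tset S)
  Tset-isCap (S-points , S-noLine) E⊕E⊆∁T = points , noLine
    where
      points : ∀ x → Tset S x → IsPoint x
      points x (inj₁ Sx)        = S-points x Sx
      points x (inj₂ (x≢0 , _)) = x≢0

      noLine-SE : ∀ x y z → S x → Ecomp S y → Tset S z → x ≢ z → y ≢ z → x ⊕ y ≢ z
      noLine-SE x y z Sx (_ , _ , y∉S⊕S) (inj₁ Sz) x≢z _ x⊕y≡z =
        y∉S⊕S (x , z , Sx , Sz , x≢z , x⊕y≡z⇒y≡x⊕z x y z x⊕y≡z)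
      noLine-SE x y z Sx Ey (inj₂ Ez) _ y≢z x⊕y≡z =
        E⊕E⊆∁T (y , z , Ey , Ez , y≢z , trans (x⊕y≡z⇒x≡z⊕y x y z x⊕y≡z) (⊕-comm z y)) (inj₁ Sx)

      noLine : ∀ x y z → Tset S x → Tset S y → Tset S z → x ≢ y → x ≢ z → y ≢ z → x ⊕ y ≢ z
      noLine x y z (inj₁ Sx) (inj₁ Sy) (inj₁ Sz) x≢y x≢z y≢z = S-noLine x y z Sx Sy Sz x≢y x≢z y≢z
      noLine x y z (inj₁ Sx) (inj₁ Sy) (inj₂ (_ , _ , z∉S⊕S)) x≢y _ _ x⊕y≡z =
        z∉S⊕S (x , y , Sx , Sy , x≢y , sym x⊕y≡z)
      noLine x y z (inj₁ Sx) (inj₂ Ey) Tz _ x≢z y≢z = noLine-SE x y z Sx Ey Tz x≢z y≢z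
      noLine x y z (inj₂ Ex) (inj₁ Sy) Tz _ x≢z y≢z x⊕y≡z =
        noLine-SE y x z Sy Ex Tz y≢z x≢z (trans (⊕-comm y x) x⊕y≡z)
      noLine x y z (inj₂ Ex) (inj₂ Ey) Tz x≢y _ _ x⊕y≡z =
        E⊕E⊆∁T (x , y , Ex , Ey , x≢y , sym x⊕y≡z) Tz

  Tset-maximal : Decidable S → ∀ T′ → IsCap T′ → Tset S ⊆ T′ → T′ ⊆ Tset S
  Tset-maximal S? T′ (T′-points , T′-noLine) T⊆T′ {x} x∈T′ with S? x
  ... | yes Sx  = inj₁ Sx
  ... | no  ¬Sx = inj₂ (T′-points x x∈T′ , ¬Sx , x∉S⊕S)
    where
      x∉S⊕S : ¬ SumSet S x
      x∉S⊕S (s , t , Ss , St , s≢t , x≡s⊕t) =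
        T′-noLine s t x s∈T′ t∈T′ x∈T′ s≢t
          (λ s≡x → T′-points t t∈T′ (identityʳ-unique s t (trans (sym x≡s⊕t) (sym s≡x))))
          (λ t≡x → T′-points s s∈T′ (identityˡ-unique s t (trans (sym x≡s⊕t) (sym t≡x))))
          (sym x≡s⊕t)
        where
          s∈T′ : T′ s
          s∈T′ = T⊆T′ (inj₁ Ss)

          t∈T′ : T′ t
          t∈T′ = T⊆T′ (inj₁ St)

  Tset-isCompleteCap : Decidable S → IsCap S → SumSet (Ecomp S) ⊆ ∁ (Tset S) → IsCompleteCap (Tset S)
  Tset-isCompleteCap S? S-cap E⊕E⊆∁T = Tset-isCap S-cap E⊕E⊆∁T , Tset-maximal S?

-- K_C = ker (a ⊕ b), H∞ = ker a ∩ ker b and H_B = {x | a·x = 1, b·x = 0}.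
module _ {S : PSet n} (S? : Decidable S) {a b c₀ : Vect n}
         (a≢0 : IsPoint a) (a≢b : a ≢ b)
         (c₀∈S : S c₀) (c₀∈K : Kernel (a ⊕ b) c₀)
         (S∩K⊆c₀ : ∀ x → S x → Kernel (a ⊕ b) x → x ≡ c₀)
         (S∩H∞≡∅ : ∀ x → S x → ¬ (Kernel a x × Kernel b x))
         (B′⊆c₀+A : ∀ x → dot a x ≡ true → Kernel b x → ¬ S x → Transl c₀ S x)
         where

  private
    a·c₀≡b·c₀ : dot a c₀ ≡ dot b c₀
    a·c₀≡b·c₀ = xor≡false⇒≡ (trans (sym (dot-⊕ˡ a b c₀)) c₀∈K)

    a·c₀ : dot a c₀ ≡ true
    a·c₀ with dot a c₀ in a·c₀≡false
    ... | true  = refl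
    ... | false = ⊥-elim (S∩H∞≡∅ c₀ c₀∈S (a·c₀≡false , trans (sym a·c₀≡b·c₀) a·c₀≡false))

    b·c₀ : dot b c₀ ≡ true
    b·c₀ = trans (sym a·c₀≡b·c₀) a·c₀

    translate-B∈S : dot a y ≡ true → Kernel b y → ¬ S y → S (c₀ ⊕ y)
    translate-B∈S {y} a·y b·y ¬Sy with B′⊆c₀+A y a·y b·y ¬Sy
    ... | s , Ss , y≡c₀⊕s = subst S (sym (trans (cong (c₀ ⊕_) y≡c₀⊕s) (x⊕[x⊕y]≡y c₀ s))) Ss

    translate∈S : dot (a ⊕ b) y ≡ true → ¬ S y → S (c₀ ⊕ y)
    translate∈S {y} [a⊕b]·y ¬Sy
      with dot a y in a·y | dot b y in b·y | trans (sym (dot-⊕ˡ a b y)) [a⊕b]·y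
    ... | true  | false | _ = translate-B∈S a·y b·y ¬Sy
    ... | false | true  | _ with S? (c₀ ⊕ y)
    ...   | yes c₀⊕y∈S = c₀⊕y∈S
    ...   | no  c₀⊕y∉S with B′⊆c₀+A (c₀ ⊕ y) (trans (dot-⊕ʳ a c₀ y) (cong₂ _xor_ a·c₀ a·y))
                                              (trans (dot-⊕ʳ b c₀ y) (cong₂ _xor_ b·c₀ b·y)) c₀⊕y∉S
    ...     | s , Ss , c₀⊕y≡c₀⊕s = ⊥-elim (¬Sy (subst S (sym (⊕-cancelˡ c₀ y s c₀⊕y≡c₀⊕s)) Ss))

    E⊆K : Ecomp S e → Kernel (a ⊕ b) e
    E⊆K {e} (e≢0 , ¬Se , e∉S⊕S) with dot (a ⊕ b) e in [a⊕b]·e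
    ... | false = refl
    ... | true  = ⊥-elim (e∉S⊕S
      (SumSet-intro c₀∈S (translate∈S [a⊕b]·e ¬Se) e≢0 (sym (x⊕[x⊕y]≡y c₀ e))))

    S∖K-inhabited : dot (a ⊕ b) h ≡ true → Σ (Vect n) λ y → S y × dot (a ⊕ b) y ≡ true
    S∖K-inhabited {h} [a⊕b]·h with S? h
    ... | yes Sh  = h , Sh , [a⊕b]·h
    ... | no  ¬Sh = c₀ ⊕ h , translate∈S [a⊕b]·h ¬Sh
                  , trans (dot-⊕ʳ (a ⊕ b) c₀ h) (cong₂ _xor_ c₀∈K [a⊕b]·h)

    S∖K-point : Σ (Vect n) λ y → S y × dot (a ⊕ b) y ≡ true
    S∖K-point with separate a≢0 a≢b
    ... | h , a·h , b·h = S∖K-inhabited (trans (dot-⊕ˡ a b h) (cong₂ _xor_ a·h b·h))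

    y₀ : Vect n
    y₀ = proj₁ S∖K-point

    y₀∈S : S y₀
    y₀∈S = proj₁ (proj₂ S∖K-point)

    [a⊕b]·y₀ : dot (a ⊕ b) y₀ ≡ true
    [a⊕b]·y₀ = proj₂ (proj₂ S∖K-point)

    shift∈S : Ecomp S e → S (c₀ ⊕ (e ⊕ y₀))
    shift∈S {e} Ee@(e≢0 , _ , e∉S⊕S) = translate∈S [a⊕b]·[e⊕y₀] e⊕y₀∉S
      where
        [a⊕b]·[e⊕y₀] : dot (a ⊕ b) (e ⊕ y₀) ≡ true
        [a⊕b]·[e⊕y₀] = trans (dot-⊕ʳ (a ⊕ b) e y₀) (cong₂ _xor_ (E⊆K Ee) [a⊕b]·y₀)

        e⊕y₀∉S : ¬ S (e ⊕ y₀)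
        e⊕y₀∉S S[e⊕y₀] = e∉S⊕S (SumSet-intro S[e⊕y₀] y₀∈S e≢0 (sym ([x⊕y]⊕y≡x e y₀)))

  E⊕E⊆∁T : SumSet (Ecomp S) ⊆ ∁ (Tset S)
  E⊕E⊆∁T (e₁ , e₂ , E₁ , E₂@(e₂≢0 , _ , e₂∉S⊕S) , _ , x≡e₁⊕e₂) (inj₁ Sx) =
    e₂∉S⊕S (SumSet-intro S[e₂⊕y₀] y₀∈S e₂≢0 (sym ([x⊕y]⊕y≡x e₂ y₀)))
    where
      e₁⊕e₂≡c₀ : e₁ ⊕ e₂ ≡ c₀
      e₁⊕e₂≡c₀ = S∩K⊆c₀ _ (subst S x≡e₁⊕e₂ Sx)
        (trans (dot-⊕ʳ (a ⊕ b) e₁ e₂) (cong₂ _xor_ (E⊆K E₁) (E⊆K E₂)))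

      S[e₂⊕y₀] : S (e₂ ⊕ y₀)
      S[e₂⊕y₀] = subst S shift≡e₂⊕y₀ (shift∈S E₁)
        where
          open ≡-Reasoning
          shift≡e₂⊕y₀ : c₀ ⊕ (e₁ ⊕ y₀) ≡ e₂ ⊕ y₀
          shift≡e₂⊕y₀ = begin
            c₀ ⊕ (e₁ ⊕ y₀)  ≡⟨ ⊕-assoc c₀ e₁ y₀ ⟨
            (c₀ ⊕ e₁) ⊕ y₀  ≡⟨ cong (_⊕ y₀) (⊕-comm c₀ e₁) ⟩
            (e₁ ⊕ c₀) ⊕ y₀  ≡⟨ cong (_⊕ y₀) (x⊕y≡z⇒y≡x⊕z e₁ e₂ c₀ e₁⊕e₂≡c₀) ⟨
            e₂ ⊕ y₀         ∎
  E⊕E⊆∁T (e₁ , e₂ , E₁ , E₂ , _ , x≡e₁⊕e₂) (inj₂ (x≢0 , _ , x∉S⊕S)) =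
    x∉S⊕S (SumSet-intro (shift∈S E₁) (shift∈S E₂) x≢0 (trans x≡e₁⊕e₂ (sym shifts-cancel)))
    where
      shifts-cancel : (c₀ ⊕ (e₁ ⊕ y₀)) ⊕ (c₀ ⊕ (e₂ ⊕ y₀)) ≡ e₁ ⊕ e₂
      shifts-cancel = trans ([x⊕y]⊕[x⊕z]≡y⊕z c₀ (e₁ ⊕ y₀) (e₂ ⊕ y₀)) ([x⊕z]⊕[y⊕z]≡x⊕y e₁ e₂ y₀)

lemma3p1 : (n : ℕ) (S : PSet n) → Decidable S → IsCap S →
    (kc u v ka kb c₀ : Vect n) →
    IsPoint kc → IsPoint u → IsPoint v → u ≢ v →
    (∀ x → (S x × Hyp kc x) → x ≡ c₀) → S c₀ → Hyp kc c₀ →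
    (∀ x → (Hyp u x × Hyp v x) → Hyp kc x) →
    (∀ x → S x → ¬ (Hyp u x × Hyp v x)) →
    IsPoint ka → IsPoint kb → ka ≢ kb → ka ≢ kc → kb ≢ kc →
    (∀ x → (Hyp u x × Hyp v x) → Hyp ka x) →
    (∀ x → (Hyp u x × Hyp v x) → Hyp kb x) →
    (λ x → (Hyp kb x × ¬ (Hyp u x × Hyp v x)) × ¬ S x)
      ≐ Transl c₀ (λ x → S x × (Hyp ka x × ¬ (Hyp u x × Hyp v x))) →
    IsCompleteCap (Tset S)
lemma3p1 n S S? S-cap kc u v ka kb c₀ kc≢0 u≢0 v≢0 u≢v S∩K_C⊆c₀ c₀∈S c₀∈K_C H∞⊆K_C S∩H∞≡∅
         ka≢0 kb≢0 ka≢kb ka≢kc kb≢kc H∞⊆K_A H∞⊆K_B (B′⊆c₀+A , _) =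
  Tset-isCompleteCap S? S-cap (E⊕E⊆∁T S? ka≢0 ka≢kb c₀∈S c₀∈K S∩K⊆c₀ S∩ker∩ker≡∅ B′⊆c₀+S)
  where
    through-H∞ : IsPoint k → (∀ x → Hyp u x × Hyp v x → Hyp k x) → Pencil u v k
    through-H∞ {k = k} k≢0 H∞⊆K =
      pencil u≢0 v≢0 u≢v k≢0 (hyperplanes-⊆⇒kernels-⊆ {u = u} {v} {k} H∞⊆K)

    rebased : Pencil u v w → Pencil ka kb w
    rebased = pencil-rebase (through-H∞ ka≢0 H∞⊆K_A) (through-H∞ kb≢0 H∞⊆K_B) ka≢kb

    kc≡ka⊕kb : kc ≡ ka ⊕ kb
    kc≡ka⊕kb = pencil-other (rebased (through-H∞ kc≢0 H∞⊆K_C)) (ka≢kc ∘ sym) (kb≢kc ∘ sym)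

    c₀∈K : Kernel (ka ⊕ kb) c₀
    c₀∈K = subst (λ k → Kernel k c₀) kc≡ka⊕kb (proj₂ c₀∈K_C)

    S∩K⊆c₀ : ∀ x → S x → Kernel (ka ⊕ kb) x → x ≡ c₀
    S∩K⊆c₀ x Sx x∈K =
      S∩K_C⊆c₀ x (Sx , proj₁ S-cap x Sx , subst (λ k → Kernel k x) (sym kc≡ka⊕kb) x∈K)

    S∩ker∩ker≡∅ : ∀ x → S x → ¬ (Kernel ka x × Kernel kb x)
    S∩ker∩ker≡∅ x Sx x∈ker = S∩H∞≡∅ x Sx ((x≢0 , pencil-kernel (rebased first) x∈ker)
                                         , (x≢0 , pencil-kernel (rebased second) x∈ker))
      where
        x≢0 : IsPoint x
        x≢0 = proj₁ S-cap x Sx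

    -- Only the inclusion B′ ⊆ c₀ + A of the hypothesis B′ = c₀ + A is needed.
    B′⊆c₀+S : ∀ x → dot ka x ≡ true → Kernel kb x → ¬ S x → Transl c₀ S x
    B′⊆c₀+S x ka·x kb·x ¬Sx with B′⊆c₀+A (((dot≡true⇒IsPoint {a = ka} ka·x , kb·x) , x∉H∞) , ¬Sx)
      where
        x∉H∞ : ¬ (Hyp u x × Hyp v x)
        x∉H∞ x∈H∞ with trans (sym ka·x) (proj₂ (H∞⊆K_A x x∈H∞))
        ... | ()
    ... | s , (Ss , _) , x≡c₀⊕s = s , Ss , x≡c₀⊕s
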